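{- Let $C,C'$ be commands, $(s,h),(s',h')\in\mathcal{S}$, and let $\rho_1=(O_1\cup O_2,L,D)$, $\rho_2=(O_1,L\cup O_2,D)$ and $\rho'=(O',L,D')$ be resource configurations. If $C,(s,h,\rho_2)\not\to_p\mathsf{abort}$ and $C,(s,h,\rho_1)\to_pC',(s',h',\rho')$, then $O_2\subseteq O'$ and $C,(s,h,\rho_2)\to_pC',(s',h',(O'\setminus O_2,L\cup O_2,D'))$.
   Context: $\mathcal{S}$: pairs of a store $s:\mathbf{Var}\to\mathbf{Val}$ and a finite partial heap $h$. A resource configuration is a triple $(O,L,D)$ of pairwise disjoint sets of resource names; $r\in\rho$ iff $r\in O\cup L\cup D$; $\rho\setminus\{r\}$ componentwise removal. Commands: $\mathsf{skip}$, basic $c$ ($x:=e$, $x:=[e]$, $[e]:=e'$, $x:=\mathsf{cons}(\dots)$, $\mathsf{dispose}(e)$) with standard semantics $[c](s,h)$ (pair or $\mathsf{abort}$), $C_1;C_2$, $\mathsf{if}$, $\mathsf{while}$, $\mathsf{resource}\ r\ \mathsf{in}\ C$, $\mathsf{with}\ r\ \mathsf{when}\ B\ \mathsf{do}\ C$, $C_1\|C_2$, $\mathsf{within}\ r\ \mathsf{do}\ C$. $Locked(C_1;C_2)=Locked(C_1)$, $Locked(C_1\|C_2)=Locked(C_1)\cup Locked(C_2)$, $Locked(\mathsf{resource}\ r\ \mathsf{in}\ C)=Locked(C)\setminus\{r\}$, $Locked(\mathsf{within}\ r\ \mathsf{do}\ C)=Locked(C)\cup\{r\}$, else $\emptyset$.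 Program transitions $\to_p$: (S1) $\mathsf{skip};C_2\to C_2$; (S2) $C_1;C_2$ steps via $C_1$; (LP) while unfolds to $\mathsf{if}\ B\ \mathsf{then}\ (C;\mathsf{while}\ B\ \mathsf{do}\ C)\ \mathsf{else}\ \mathsf{skip}$; (IF1/IF2) by $s(B)$; (P1/P2) a parallel component steps; (P3) $\mathsf{skip}\|\mathsf{skip}\to\mathsf{skip}$; (R0) $\mathsf{resource}\ r\ \mathsf{in}\ \mathsf{skip}\to\mathsf{skip}$ if $r\notin\rho$; (R1) if $r\notin\rho=(O,L,D)$, $r\in Locked(C)$, $C,(s,h,(O\cup\{r\},L,D))\to_pC',(s',h',\rho')$ then $\mathsf{resource}\ r\ \mathsf{in}\ C,(s,h,\rho)\to_p\mathsf{resource}\ r\ \mathsf{in}\ C',(s',h',\rho'\setminus\{r\})$; (R2) same with $r\notin Locked(C)$ and $(O,L,D\cup\{r\})$; (W0) $\mathsf{with}\ r\ \mathsf{when}\ B\ \mathsf{do}\ C,(s,h,(O,L,D\cup\{r\}))\to_p\mathsf{within}\ r\ \mathsf{do}\ C,(s,h,(O\cup\{r\},L,D))$ if $s(B)=\texttt{true}$; (W1) if $r\in O$ and $C,(s,h,(O\setminus\{r\},L,D))\to_pC',(s',h',(O',L',D'))$ then $\mathsf{within}\ r\ \mathsf{do}\ C,(s,h,(O,L,D))\to_p\mathsf{within}\ r\ \mathsf{do}\ C',(s',h',(O'\cup\{r\},L',D'))$; (W2) $\mathsf{within}\ r\ \mathsf{do}\ \mathsf{skip},(s,h,(O\cup\{r\},L,D))\to_p\mathsf{skip},(s,h,(O,L,D\cup\{r\}))$;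 (BCT) $c,(s,h,\rho)\to_p\mathsf{skip},(s',h',\rho)$ if $[c](s,h)=(s',h')$. Abort transitions: (RA) $\mathsf{resource}\ r$ with $r\in\rho$; (WA) $\mathsf{with}\ r$ with $r\notin\rho$; (RA1)/(RA2) body aborts under the configuration used in (R1)/(R2); (BCA) $[c](s,h)=\mathsf{abort}$; (SA) first component of $;$ aborts; (WA1) body of $\mathsf{within}\ r$ aborts under $\rho\setminus\{r\}$; (WA2) $\mathsf{within}\ r$ with $r\notin O$; (PA1/PA2) a component of $\|$ aborts. -}

module Defs where

open import Level using (0ℓ)
open import Data.Nat using (ℕ; _+_; _∸_; _<_; _≡ᵇ_; _<ᵇ_)
open import Data.Bool using (Bool; true; false; not; _∧_)
open import Data.Product using (_×_; _,_; Σ; ∃)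
open import Data.Sum using (_⊎_)
open import Data.Empty using (⊥)
open import Data.Maybe using (Maybe; just; nothing)
open import Data.List using (List; []; _∷_; length; filter)
open import Relation.Nullary using (¬_)
open import Relation.Nullary.Decidable using (does)
open import Relation.Binary.PropositionalEquality using (_≡_; _≢_)
import Data.Nat as ℕ

Var : Set
Var = ℕ

Val : Set
Val = ℕ

Loc : Set
Loc = ℕ

Store : Set
Store = Var → Val

-- a finite partial heap, represented by a finite association list
-- (the first binding of a location is the one that counts)
Heap : Set
Heap = List (Loc × Val)

lookupH : Heap → Loc → Maybe Val
lookupH []             l = nothing
lookupH ((k , v) ∷ h)  l = if does (k ℕ.≟ l) then just v else lookupH h l
  where open Data.Bool using (if_then_else_)

_∈dom_ : Loc → Heap → Set
l ∈dom h = Σ Val λ v → lookupH h l ≡ just v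

removeH : Heap → Loc → Heap
removeH h l = filter (λ kv → Relation.Nullary.¬? (Data.Product.proj₁ kv ℕ.≟ l)) h

updateH : Heap → Loc → Val → Heap
updateH h l v = (l , v) ∷ removeH h l

_[_↦_] : Store → Var → Val → Store
(s [ x ↦ v ]) y = if does (y ℕ.≟ x) then v else s y
  where open Data.Bool using (if_then_else_)

data Exp : Set where
  num  : Val → Exp
  var  : Var → Exp
  _⊕_  : Exp → Exp → Exp
  _⊖_  : Exp → Exp → Exp

data BExp : Set where
  tt ff  : BExp
  _≐ᵉ_   : Exp → Exp → BExp
  _<ᵉ_   : Exp → Exp → BExp
  ¬ᵉ_    : BExp → BExp
  _∧ᵉ_   : BExp → BExp → BExp

⟦_⟧ₑ : Exp → Store → Val
⟦ num n ⟧ₑ s = n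
⟦ var x ⟧ₑ s = s x
⟦ e ⊕ e' ⟧ₑ s = ⟦ e ⟧ₑ s + ⟦ e' ⟧ₑ s
⟦ e ⊖ e' ⟧ₑ s = ⟦ e ⟧ₑ s ∸ ⟦ e' ⟧ₑ s

⟦_⟧ᵦ : BExp → Store → Bool
⟦ tt ⟧ᵦ s = true
⟦ ff ⟧ᵦ s = false
⟦ e ≐ᵉ e' ⟧ᵦ s = ⟦ e ⟧ₑ s ≡ᵇ ⟦ e' ⟧ₑ s
⟦ e <ᵉ e' ⟧ᵦ s = ⟦ e ⟧ₑ s <ᵇ ⟦ e' ⟧ₑ s
⟦ ¬ᵉ b ⟧ᵦ s = not (⟦ b ⟧ᵦ s)
⟦ b ∧ᵉ b' ⟧ᵦ s = ⟦ b ⟧ᵦ s ∧ ⟦ b' ⟧ᵦ s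

data Basic : Set where
  assign  : Var → Exp → Basic
  load    : Var → Exp → Basic          -- x := [e]
  store   : Exp → Exp → Basic          -- [e] := e'
  cons    : Var → List Exp → Basic     -- x := cons(e1,...,en)
  dispose : Exp → Basic

allocH : Heap → Loc → List Val → Heap
allocH h l []       = h
allocH h l (v ∷ vs) = (l , v) ∷ allocH h (ℕ.suc l) vs

evalList : List Exp → Store → List Val
evalList []       s = []
evalList (e ∷ es) s = ⟦ e ⟧ₑ s ∷ evalList es s

-- [c](s,h) = (s',h')   (a relation, since cons chooses fresh locations)
data BasicOk : Basic → Store → Heap → Store → Heap → Set where
  ok-assign  : ∀ {x e s h} →
    BasicOk (assign x e) s h (s [ x ↦ ⟦ e ⟧ₑ s ]) h
  ok-load    : ∀ {x e s h v} → lookupH h (⟦ e ⟧ₑ s) ≡ just v →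
    BasicOk (load x e) s h (s [ x ↦ v ]) h
  ok-store   : ∀ {e e' s h} → ⟦ e ⟧ₑ s ∈dom h →
    BasicOk (store e e') s h s (updateH h (⟦ e ⟧ₑ s) (⟦ e' ⟧ₑ s))
  ok-cons    : ∀ {x es s h} (l : Loc) →
    (∀ i → i < length es → ¬ ((l + i) ∈dom h)) →
    BasicOk (cons x es) s h (s [ x ↦ l ]) (allocH h l (evalList es s))
  ok-dispose : ∀ {e s h} → ⟦ e ⟧ₑ s ∈dom h →
    BasicOk (dispose e) s h s (removeH h (⟦ e ⟧ₑ s))

data BasicAbort : Basic → Store → Heap → Set where
  ab-load    : ∀ {x e s h} → lookupH h (⟦ e ⟧ₑ s) ≡ nothing → BasicAbort (load x e) s h
  ab-store   : ∀ {e e' s h} → ¬ (⟦ e ⟧ₑ s ∈dom h) → BasicAbort (store e e') s h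
  ab-dispose : ∀ {e s h} → ¬ (⟦ e ⟧ₑ s ∈dom h) → BasicAbort (dispose e) s h

Res : Set
Res = ℕ

RSet : Set₁
RSet = Res → Set

∅ : RSet
∅ _ = ⊥

_∪_ : RSet → RSet → RSet
(A ∪ B) x = A x ⊎ B x

_∖_ : RSet → RSet → RSet
(A ∖ B) x = A x × ¬ B x

❴_❵ : Res → RSet
❴ r ❵ x = x ≡ r

_⊆_ : RSet → RSet → Set
A ⊆ B = ∀ x → A x → B x

_≃_ : RSet → RSet → Set
A ≃ B = (A ⊆ B) × (B ⊆ A)

DisjointS : RSet → RSet → Set
DisjointS A B = ∀ x → A x → B x → ⊥

record RConf : Set₁ where
  constructor ⟨_,_,_⟩
  field
    O L D : RSet
open RConf public

IsResConf : RConf → Set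
IsResConf ρ = DisjointS (O ρ) (L ρ) × DisjointS (O ρ) (D ρ) × DisjointS (L ρ) (D ρ)

_∈ρ_ : Res → RConf → Set
r ∈ρ ρ = O ρ r ⊎ L ρ r ⊎ D ρ r

_∖ρ_ : RConf → Res → RConf
ρ ∖ρ r = ⟨ O ρ ∖ ❴ r ❵ , L ρ ∖ ❴ r ❵ , D ρ ∖ ❴ r ❵ ⟩

_≅_ : RConf → RConf → Set
ρ ≅ ρ' = (O ρ ≃ O ρ') × (L ρ ≃ L ρ') × (D ρ ≃ D ρ')

data Cmd : Set where
  skip            : Cmd
  basic           : Basic → Cmd
  _⨾_             : Cmd → Cmd → Cmd
  if_then_else_   : BExp → Cmd → Cmd → Cmd
  while_do′_       : BExp → Cmd → Cmd
  resource_in′_    : Res → Cmd → Cmd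
  with′_when_do′_   : Res → BExp → Cmd → Cmd
  _∥_             : Cmd → Cmd → Cmd
  within_do′_      : Res → Cmd → Cmd

Locked : Cmd → RSet
Locked (C₁ ⨾ C₂)          = Locked C₁
Locked (C₁ ∥ C₂)          = Locked C₁ ∪ Locked C₂
Locked (resource r in′ C)  = Locked C ∖ ❴ r ❵
Locked (within r do′ C)    = Locked C ∪ ❴ r ❵
Locked skip                 = ∅
Locked (basic _)            = ∅
Locked (if _ then _ else _) = ∅
Locked (while _ do′ _)       = ∅
Locked (with′ _ when _ do′ _) = ∅

record State : Set where
  constructor st
  field
    sto : Store
    hp  : Heap
open State public

-- Program transitions  C,(s,h,ρ) →p C',(s',h',ρ')
-- Sets of resource names are predicates, so configurations that the rules
-- compute (ρ∖{r}, O∪{r}, ...) are matched up to extensional equality ≅.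

data _,_,_⟶_,_,_ : Cmd → State → RConf → Cmd → State → RConf → Set₁ where
  S1  : ∀ {C₂ σ ρ ρ'} → ρ' ≅ ρ → (skip ⨾ C₂) , σ , ρ ⟶ C₂ , σ , ρ'
  S2  : ∀ {C₁ C₁' C₂ σ σ' ρ ρ'} → C₁ , σ , ρ ⟶ C₁' , σ' , ρ' →
        (C₁ ⨾ C₂) , σ , ρ ⟶ (C₁' ⨾ C₂) , σ' , ρ'
  LP  : ∀ {B C σ ρ ρ'} → ρ' ≅ ρ →
        (while B do′ C) , σ , ρ ⟶ (if B then (C ⨾ (while B do′ C)) else skip) , σ , ρ'
  IF1 : ∀ {B C₁ C₂ σ ρ ρ'} → ⟦ B ⟧ᵦ (sto σ) ≡ true → ρ' ≅ ρ →
        (if B then C₁ else C₂) , σ , ρ ⟶ C₁ , σ , ρ'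
  IF2 : ∀ {B C₁ C₂ σ ρ ρ'} → ⟦ B ⟧ᵦ (sto σ) ≡ false → ρ' ≅ ρ →
        (if B then C₁ else C₂) , σ , ρ ⟶ C₂ , σ , ρ'
  P1  : ∀ {C₁ C₁' C₂ σ σ' ρ ρ'} → C₁ , σ , ρ ⟶ C₁' , σ' , ρ' →
        (C₁ ∥ C₂) , σ , ρ ⟶ (C₁' ∥ C₂) , σ' , ρ'
  P2  : ∀ {C₁ C₂ C₂' σ σ' ρ ρ'} → C₂ , σ , ρ ⟶ C₂' , σ' , ρ' →
        (C₁ ∥ C₂) , σ , ρ ⟶ (C₁ ∥ C₂') , σ' , ρ'
  P3  : ∀ {σ ρ ρ'} → ρ' ≅ ρ → (skip ∥ skip) , σ , ρ ⟶ skip , σ , ρ'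
  R0  : ∀ {r σ ρ ρ'} → ¬ (r ∈ρ ρ) → ρ' ≅ ρ →
        (resource r in′ skip) , σ , ρ ⟶ skip , σ , ρ'
  R1  : ∀ {r C C' σ σ' ρ ρ₀ ρ' ρ''} → ¬ (r ∈ρ ρ) → Locked C r →
        ρ₀ ≅ ⟨ O ρ ∪ ❴ r ❵ , L ρ , D ρ ⟩ →
        C , σ , ρ₀ ⟶ C' , σ' , ρ' →
        ρ'' ≅ (ρ' ∖ρ r) →
        (resource r in′ C) , σ , ρ ⟶ (resource r in′ C') , σ' , ρ''
  R2  : ∀ {r C C' σ σ' ρ ρ₀ ρ' ρ''} → ¬ (r ∈ρ ρ) → ¬ Locked C r →
        ρ₀ ≅ ⟨ O ρ , L ρ , D ρ ∪ ❴ r ❵ ⟩ →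
        C , σ , ρ₀ ⟶ C' , σ' , ρ' →
        ρ'' ≅ (ρ' ∖ρ r) →
        (resource r in′ C) , σ , ρ ⟶ (resource r in′ C') , σ' , ρ''
  W0  : ∀ {r B C σ ρ ρ'} → D ρ r → ⟦ B ⟧ᵦ (sto σ) ≡ true →
        ρ' ≅ ⟨ O ρ ∪ ❴ r ❵ , L ρ , D ρ ∖ ❴ r ❵ ⟩ →
        (with′ r when B do′ C) , σ , ρ ⟶ (within r do′ C) , σ , ρ'
  W1  : ∀ {r C C' σ σ' ρ ρ₀ ρ' ρ''} → O ρ r →
        ρ₀ ≅ ⟨ O ρ ∖ ❴ r ❵ , L ρ , D ρ ⟩ →
        C , σ , ρ₀ ⟶ C' , σ' , ρ' →
        ρ'' ≅ ⟨ O ρ' ∪ ❴ r ❵ , L ρ' , D ρ' ⟩ →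
        (within r do′ C) , σ , ρ ⟶ (within r do′ C') , σ' , ρ''
  W2  : ∀ {r σ ρ ρ'} → O ρ r →
        ρ' ≅ ⟨ O ρ ∖ ❴ r ❵ , L ρ , D ρ ∪ ❴ r ❵ ⟩ →
        (within r do′ skip) , σ , ρ ⟶ skip , σ , ρ'
  BCT : ∀ {c s h s' h' ρ ρ'} → BasicOk c s h s' h' → ρ' ≅ ρ →
        basic c , st s h , ρ ⟶ skip , st s' h' , ρ'

data _,_,_⟶abort : Cmd → State → RConf → Set₁ where
  RA  : ∀ {r C σ ρ} → r ∈ρ ρ → (resource r in′ C) , σ , ρ ⟶abort
  WA  : ∀ {r B C σ ρ} → ¬ (r ∈ρ ρ) → (with′ r when B do′ C) , σ , ρ ⟶abort
  RA1 : ∀ {r C σ ρ ρ₀} → ¬ (r ∈ρ ρ) → Locked C r →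
        ρ₀ ≅ ⟨ O ρ ∪ ❴ r ❵ , L ρ , D ρ ⟩ → C , σ , ρ₀ ⟶abort →
        (resource r in′ C) , σ , ρ ⟶abort
  RA2 : ∀ {r C σ ρ ρ₀} → ¬ (r ∈ρ ρ) → ¬ Locked C r →
        ρ₀ ≅ ⟨ O ρ , L ρ , D ρ ∪ ❴ r ❵ ⟩ → C , σ , ρ₀ ⟶abort →
        (resource r in′ C) , σ , ρ ⟶abort
  BCA : ∀ {c s h ρ} → BasicAbort c s h → basic c , st s h , ρ ⟶abort
  SA  : ∀ {C₁ C₂ σ ρ} → C₁ , σ , ρ ⟶abort → (C₁ ⨾ C₂) , σ , ρ ⟶abort
  WA1 : ∀ {r C σ ρ ρ₀} → ρ₀ ≅ (ρ ∖ρ r) → C , σ , ρ₀ ⟶abort →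
        (within r do′ C) , σ , ρ ⟶abort
  WA2 : ∀ {r C σ ρ} → ¬ (O ρ r) → (within r do′ C) , σ , ρ ⟶abort
  PA1 : ∀ {C₁ C₂ σ ρ} → C₁ , σ , ρ ⟶abort → (C₁ ∥ C₂) , σ , ρ ⟶abort
  PA2 : ∀ {C₁ C₂ σ ρ} → C₂ , σ , ρ ⟶abort → (C₁ ∥ C₂) , σ , ρ ⟶abort

-- Locking owned resources X is invisible to a step that does not abort in the
-- locked configuration.  Each rule touches only the name r it mentions, and
-- r ∉ X: for R1/R2 it is fresh, for W0 it is in D, and for W1/W2 a name of X
-- would no longer be owned in the locked configuration, which then aborts
-- (WA2).  Hence every side condition and every resulting configuration
-- translates along moving X from O to L.
module Submission where

open import Data.Product using (_×_; _,_; proj₁; proj₂; map₂)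
open import Data.Sum using (inj₁; inj₂; [_,_]′) renaming (map₁ to ⊎-map₁)
open import Data.Empty using (⊥-elim)
open import Function using (_∘_; id)
open import Relation.Nullary using (¬_)
open import Relation.Binary.PropositionalEquality using (refl)

open import Defs

⊆-refl : ∀ {A} → A ⊆ A
⊆-refl _ a = a

≃-refl : ∀ {A} → A ≃ A
≃-refl = ⊆-refl , ⊆-refl

≃-sym : ∀ {A B} → A ≃ B → B ≃ A
≃-sym (p , q) = q , p

≃-trans : ∀ {A B C} → A ≃ B → B ≃ C → A ≃ C
≃-trans (p , q) (p′ , q′) = (λ x → p′ x ∘ p x) , (λ x → q x ∘ q′ x)

≅-refl : ∀ {ρ} → ρ ≅ ρ
≅-refl = ≃-refl , ≃-refl , ≃-refl

≅-trans : ∀ {ρ ρ′ ρ″} → ρ ≅ ρ′ → ρ′ ≅ ρ″ → ρ ≅ ρ″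
≅-trans (o , l , d) (o′ , l′ , d′) = ≃-trans o o′ , ≃-trans l l′ , ≃-trans d d′

∪-congˡ : ∀ {A B C} → A ≃ B → (A ∪ C) ≃ (B ∪ C)
∪-congˡ (p , q) = (λ x → ⊎-map₁ (p x)) , (λ x → ⊎-map₁ (q x))

∖-congˡ : ∀ {A B C} → A ≃ B → (A ∖ C) ≃ (B ∖ C)
∖-congˡ (p , q) = (λ { x (a , c) → p x a , c }) , (λ { x (b , c) → q x b , c })

∖-comm : ∀ {A B C} → ((A ∖ B) ∖ C) ≃ ((A ∖ C) ∖ B)
∖-comm = (λ { x ((a , b) , c) → (a , c) , b }) , (λ { x ((a , c) , b) → (a , b) , c })

∪∖-comm : ∀ {A B C} → DisjointS B C → ((A ∪ B) ∖ C) ≃ ((A ∖ C) ∪ B)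
∪∖-comm B#C =
  (λ { x (inj₁ a , c) → inj₁ (a , c) ; x (inj₂ b , _) → inj₂ b }) ,
  (λ { x (inj₁ (a , c)) → inj₁ a , c ; x (inj₂ b) → inj₂ b , B#C x b })

DisjointS-sym : ∀ {A B} → DisjointS A B → DisjointS B A
DisjointS-sym A#B x b a = A#B x a b

∉⇒#❴❵ : ∀ {A r} → ¬ A r → DisjointS A ❴ r ❵
∉⇒#❴❵ r∉A _ a refl = r∉A a

∉⇒≃∖❴❵ : ∀ {A r} → ¬ A r → A ≃ (A ∖ ❴ r ❵)
∉⇒≃∖❴❵ r∉A = (λ x a → a , ∉⇒#❴❵ r∉A x a) , (λ _ → proj₁)

IsResConf-resp-≅ : ∀ {ρ ρ′} → ρ ≅ ρ′ → IsResConf ρ′ → IsResConf ρ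
IsResConf-resp-≅ ((o , _) , (l , _) , (d , _)) (O#L , O#D , L#D) =
  (λ x a b → O#L x (o x a) (l x b)) ,
  (λ x a b → O#D x (o x a) (d x b)) ,
  (λ x a b → L#D x (l x a) (d x b))

IsResConf-∪O : ∀ {r ρ} → ¬ r ∈ρ ρ → IsResConf ρ → IsResConf ⟨ O ρ ∪ ❴ r ❵ , L ρ , D ρ ⟩
IsResConf-∪O r∉ρ (O#L , O#D , L#D) =
  (λ { x (inj₁ o) → O#L x o ; x (inj₂ refl) → r∉ρ ∘ inj₂ ∘ inj₁ }) ,
  (λ { x (inj₁ o) → O#D x o ; x (inj₂ refl) → r∉ρ ∘ inj₂ ∘ inj₂ }) ,
  L#D

IsResConf-∪D : ∀ {r ρ} → ¬ r ∈ρ ρ → IsResConf ρ → IsResConf ⟨ O ρ , L ρ , D ρ ∪ ❴ r ❵ ⟩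
IsResConf-∪D r∉ρ (O#L , O#D , L#D) =
  O#L ,
  (λ { x o (inj₁ d) → O#D x o d ; x o (inj₂ refl) → r∉ρ (inj₁ o) }) ,
  (λ { x l (inj₁ d) → L#D x l d ; x l (inj₂ refl) → r∉ρ (inj₂ (inj₁ l)) })

IsResConf-∖O : ∀ {Y ρ} → IsResConf ρ → IsResConf ⟨ O ρ ∖ Y , L ρ , D ρ ⟩
IsResConf-∖O (O#L , O#D , L#D) = (λ x → O#L x ∘ proj₁) , (λ x → O#D x ∘ proj₁) , L#D

lockOwned : RSet → RConf → RConf
lockOwned X ρ = ⟨ O ρ ∖ X , L ρ ∪ X , D ρ ⟩

lockOwned-cong : ∀ {X ρ ρ′} → ρ ≅ ρ′ → lockOwned X ρ ≅ lockOwned X ρ′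
lockOwned-cong (o , l , d) = ∖-congˡ o , ∪-congˡ l , d

lockOwned-∖ρ : ∀ {X r ρ} → ¬ X r → lockOwned X (ρ ∖ρ r) ≅ (lockOwned X ρ ∖ρ r)
lockOwned-∖ρ r∉X = ∖-comm , ≃-sym (∪∖-comm (∉⇒#❴❵ r∉X)) , ≃-refl

lockOwned-∖ρ-target : ∀ {X r ρ ρ′} → ¬ X r → X ⊆ O ρ → ρ′ ≅ (ρ ∖ρ r) →
  (X ⊆ O ρ′) × (lockOwned X ρ′ ≅ (lockOwned X ρ ∖ρ r))
lockOwned-∖ρ-target r∉X X⊆O e =
  (λ x x∈X → proj₂ (proj₁ e) x (X⊆O x x∈X , ∉⇒#❴❵ r∉X x x∈X)) ,
  ≅-trans (lockOwned-cong e) (lockOwned-∖ρ r∉X)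

lockOwned-∪O-target : ∀ {X r ρ ρ′} → ¬ X r → X ⊆ O ρ → ρ′ ≅ ⟨ O ρ ∪ ❴ r ❵ , L ρ , D ρ ⟩ →
  (X ⊆ O ρ′) × (lockOwned X ρ′ ≅ ⟨ (O ρ ∖ X) ∪ ❴ r ❵ , L ρ ∪ X , D ρ ⟩)
lockOwned-∪O-target r∉X X⊆O e =
  (λ x x∈X → proj₂ (proj₁ e) x (inj₁ (X⊆O x x∈X))) ,
  ≅-trans (lockOwned-cong e) (∪∖-comm (DisjointS-sym (∉⇒#❴❵ r∉X)) , ≃-refl , ≃-refl)

-- Stronger than ρ₂ ≅ lockOwned X ρ₁: that only gives O ρ₂ ≃ O ρ₁ ∖ X, which
-- without decidability of X does not split O ρ₁ into O ρ₂ and X.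
record OwnedLocked (X : RSet) (ρ₁ ρ₂ : RConf) : Set where
  field
    O-split : O ρ₁ ≃ (O ρ₂ ∪ X)
    X#O     : DisjointS X (O ρ₂)
    L-split : L ρ₂ ≃ (L ρ₁ ∪ X)
    D-same  : D ρ₁ ≃ D ρ₂

  locked⊆owned : X ⊆ O ρ₁
  locked⊆owned x = proj₂ O-split x ∘ inj₂

module _ {X ρ₁ ρ₂} (m : OwnedLocked X ρ₁ ρ₂) where
  open OwnedLocked m

  lockOwned-≅ : lockOwned X ρ₁ ≅ ρ₂
  lockOwned-≅ =
    ( (λ { x (o , x∉X) → [ id , ⊥-elim ∘ x∉X ]′ (proj₁ O-split x o) })
    , (λ x o → proj₂ O-split x (inj₁ o) , λ x∈X → X#O x x∈X o) )
    , ≃-sym L-split , D-same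

  owned-unlocked : ∀ {r} → O ρ₁ r → ¬ X r → O ρ₂ r
  owned-unlocked {r} o r∉X = [ id , ⊥-elim ∘ r∉X ]′ (proj₁ O-split r o)

  ∉ρ-locked : ∀ {r} → ¬ r ∈ρ ρ₁ → ¬ r ∈ρ ρ₂
  ∉ρ-locked r∉ρ₁ (inj₁ o) = r∉ρ₁ (inj₁ (proj₂ O-split _ (inj₁ o)))
  ∉ρ-locked r∉ρ₁ (inj₂ (inj₁ l)) =
    [ r∉ρ₁ ∘ inj₂ ∘ inj₁ , r∉ρ₁ ∘ inj₁ ∘ locked⊆owned _ ]′ (proj₁ L-split _ l)
  ∉ρ-locked r∉ρ₁ (inj₂ (inj₂ d)) = r∉ρ₁ (inj₂ (inj₂ (proj₂ D-same _ d)))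

OwnedLocked-resp-≅ : ∀ {X ρ ρ₁ ρ₂} → ρ ≅ ρ₁ → OwnedLocked X ρ₁ ρ₂ → OwnedLocked X ρ ρ₂
OwnedLocked-resp-≅ (o , l , d) m = record
  { O-split = ≃-trans o O-split
  ; X#O     = X#O
  ; L-split = ≃-trans L-split (∪-congˡ (≃-sym l))
  ; D-same  = ≃-trans d D-same
  }
  where open OwnedLocked m

OwnedLocked-∪O : ∀ {X Y ρ₁ ρ₂} → DisjointS X Y → OwnedLocked X ρ₁ ρ₂ →
  OwnedLocked X ⟨ O ρ₁ ∪ Y , L ρ₁ , D ρ₁ ⟩ ⟨ O ρ₂ ∪ Y , L ρ₂ , D ρ₂ ⟩
OwnedLocked-∪O X#Y m = record
  { O-split =
      (λ { x (inj₁ o) → ⊎-map₁ inj₁ (proj₁ O-split x o) ; x (inj₂ y) → inj₁ (inj₂ y) }) ,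
      (λ { x (inj₁ (inj₁ o)) → inj₁ (proj₂ O-split x (inj₁ o))
         ; x (inj₁ (inj₂ y)) → inj₂ y
         ; x (inj₂ x∈X)      → inj₁ (locked⊆owned x x∈X) })
  ; X#O     = λ { x x∈X (inj₁ o) → X#O x x∈X o ; x x∈X (inj₂ y) → X#Y x x∈X y }
  ; L-split = L-split
  ; D-same  = D-same
  }
  where open OwnedLocked m

OwnedLocked-∖O : ∀ {X Y ρ₁ ρ₂} → DisjointS X Y → OwnedLocked X ρ₁ ρ₂ →
  OwnedLocked X ⟨ O ρ₁ ∖ Y , L ρ₁ , D ρ₁ ⟩ ⟨ O ρ₂ ∖ Y , L ρ₂ , D ρ₂ ⟩
OwnedLocked-∖O X#Y m = record
  { O-split =
      (λ { x (o , y∉) → ⊎-map₁ (_, y∉) (proj₁ O-split x o) }) ,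
      (λ { x (inj₁ (o , y∉)) → proj₂ O-split x (inj₁ o) , y∉
         ; x (inj₂ x∈X)      → locked⊆owned x x∈X , X#Y x x∈X })
  ; X#O     = λ x x∈X → X#O x x∈X ∘ proj₁
  ; L-split = L-split
  ; D-same  = D-same
  }
  where open OwnedLocked m

OwnedLocked-∪D : ∀ {X Y ρ₁ ρ₂} → OwnedLocked X ρ₁ ρ₂ →
  OwnedLocked X ⟨ O ρ₁ , L ρ₁ , D ρ₁ ∪ Y ⟩ ⟨ O ρ₂ , L ρ₂ , D ρ₂ ∪ Y ⟩
OwnedLocked-∪D m = record { O-split = O-split ; X#O = X#O ; L-split = L-split ; D-same = ∪-congˡ D-same }
  where open OwnedLocked m

OwnedLocked-∖D : ∀ {X Y ρ₁ ρ₂} → OwnedLocked X ρ₁ ρ₂ →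
  OwnedLocked X ⟨ O ρ₁ , L ρ₁ , D ρ₁ ∖ Y ⟩ ⟨ O ρ₂ , L ρ₂ , D ρ₂ ∖ Y ⟩
OwnedLocked-∖D m = record { O-split = O-split ; X#O = X#O ; L-split = L-split ; D-same = ∖-congˡ D-same }
  where open OwnedLocked m

lockOwned-target : ∀ {X ρ ρ′ ρ₂} → ρ′ ≅ ρ → OwnedLocked X ρ ρ₂ →
  (X ⊆ O ρ′) × (lockOwned X ρ′ ≅ ρ₂)
lockOwned-target e m = OwnedLocked.locked⊆owned m′ , lockOwned-≅ m′
  where m′ = OwnedLocked-resp-≅ e m

step-lockOwned : ∀ {X C C′ σ σ′ ρ₁ ρ₂ ρ′} →
  IsResConf ρ₁ → OwnedLocked X ρ₁ ρ₂ → ¬ (C , σ , ρ₂ ⟶abort) →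
  C , σ , ρ₁ ⟶ C′ , σ′ , ρ′ →
  (X ⊆ O ρ′) × (C , σ , ρ₂ ⟶ C′ , σ′ , lockOwned X ρ′)
step-lockOwned rc m na (S1 e)      = map₂ S1 (lockOwned-target e m)
step-lockOwned rc m na (LP e)      = map₂ LP (lockOwned-target e m)
step-lockOwned rc m na (IF1 b e)   = map₂ (IF1 b) (lockOwned-target e m)
step-lockOwned rc m na (IF2 b e)   = map₂ (IF2 b) (lockOwned-target e m)
step-lockOwned rc m na (P3 e)      = map₂ P3 (lockOwned-target e m)
step-lockOwned rc m na (BCT ok e)  = map₂ (BCT ok) (lockOwned-target e m)
step-lockOwned rc m na (R0 r∉ρ e)  =
  map₂ (R0 (∉ρ-locked m r∉ρ)) (lockOwned-target e m)
step-lockOwned rc m na (S2 s) = map₂ S2 (step-lockOwned rc m (na ∘ SA) s)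
step-lockOwned rc m na (P1 s) = map₂ P1 (step-lockOwned rc m (na ∘ PA1) s)
step-lockOwned rc m na (P2 s) = map₂ P2 (step-lockOwned rc m (na ∘ PA2) s)
step-lockOwned rc m na (W0 {r = r} d b e) =
  map₂ (W0 (proj₁ (OwnedLocked.D-same m) r d) b)
    (lockOwned-target e (OwnedLocked-∖D (OwnedLocked-∪O (∉⇒#❴❵ r∉X) m)))
  where r∉X = λ r∈X → proj₁ (proj₂ rc) r (OwnedLocked.locked⊆owned m r r∈X) d
step-lockOwned rc m na (W2 {r = r} o e) =
  map₂ (W2 (owned-unlocked m o r∉X))
    (lockOwned-target e (OwnedLocked-∪D (OwnedLocked-∖O (∉⇒#❴❵ r∉X) m)))
  where r∉X = λ r∈X → na (WA2 (OwnedLocked.X#O m r r∈X))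
step-lockOwned {X} {ρ₂ = ρ₂} rc m na (W1 {r = r} o e₀ s e) =
  map₂ (W1 (owned-unlocked m o r∉X) ≅-refl s′) (lockOwned-∪O-target r∉X X⊆O e)
  where
    open OwnedLocked m
    r∉X : ¬ X r
    r∉X r∈X = na (WA2 (X#O r r∈X))
    r∉L₂ : ¬ L ρ₂ r
    r∉L₂ l = [ proj₁ rc r o , r∉X ]′ (proj₁ L-split r l)
    r∉D₂ : ¬ D ρ₂ r
    r∉D₂ d = proj₁ (proj₂ rc) r o (proj₂ D-same r d)
    inner = step-lockOwned (IsResConf-resp-≅ e₀ (IsResConf-∖O rc))
      (OwnedLocked-resp-≅ e₀ (OwnedLocked-∖O (∉⇒#❴❵ r∉X) m))
      (na ∘ WA1 (≃-refl , ∉⇒≃∖❴❵ r∉L₂ , ∉⇒≃∖❴❵ r∉D₂)) s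
    X⊆O = proj₁ inner
    s′ = proj₂ inner
step-lockOwned rc m na (R1 {r = r} r∉ρ lk e₀ s e) =
  map₂ (R1 r∉ρ₂ lk ≅-refl s′) (lockOwned-∖ρ-target r∉X X⊆O e)
  where
    r∉ρ₂ = ∉ρ-locked m r∉ρ
    r∉X = r∉ρ ∘ inj₁ ∘ OwnedLocked.locked⊆owned m r
    inner = step-lockOwned (IsResConf-resp-≅ e₀ (IsResConf-∪O r∉ρ rc))
      (OwnedLocked-resp-≅ e₀ (OwnedLocked-∪O (∉⇒#❴❵ r∉X) m))
      (na ∘ RA1 r∉ρ₂ lk ≅-refl) s
    X⊆O = proj₁ inner
    s′ = proj₂ inner
step-lockOwned rc m na (R2 {r = r} r∉ρ lk e₀ s e) =
  map₂ (R2 r∉ρ₂ lk ≅-refl s′) (lockOwned-∖ρ-target r∉X X⊆O e)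
  where
    r∉ρ₂ = ∉ρ-locked m r∉ρ
    r∉X = r∉ρ ∘ inj₁ ∘ OwnedLocked.locked⊆owned m r
    inner = step-lockOwned (IsResConf-resp-≅ e₀ (IsResConf-∪D r∉ρ rc))
      (OwnedLocked-resp-≅ e₀ (OwnedLocked-∪D m))
      (na ∘ RA2 r∉ρ₂ lk ≅-refl) s
    X⊆O = proj₁ inner
    s′ = proj₂ inner

proposition7 : (C C' : Cmd) (s s' : Store) (h h' : Heap)
    (O₁ O₂ L D O' D' : RSet) →
    IsResConf ⟨ O₁ ∪ O₂ , L , D ⟩ →
    IsResConf ⟨ O₁ , L ∪ O₂ , D ⟩ →
    IsResConf ⟨ O' , L , D' ⟩ →
    ¬ (C , st s h , ⟨ O₁ , L ∪ O₂ , D ⟩ ⟶abort) →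
    C , st s h , ⟨ O₁ ∪ O₂ , L , D ⟩ ⟶ C' , st s' h' , ⟨ O' , L , D' ⟩ →
    (O₂ ⊆ O') × (C , st s h , ⟨ O₁ , L ∪ O₂ , D ⟩ ⟶ C' , st s' h' , ⟨ O' ∖ O₂ , L ∪ O₂ , D' ⟩)
proposition7 C C' s s' h h' O₁ O₂ L D O' D' rc₁ (O₁#L∪O₂ , _) _ na step =
  step-lockOwned rc₁ O₂-locked na step
  where
    O₂-locked : OwnedLocked O₂ ⟨ O₁ ∪ O₂ , L , D ⟩ ⟨ O₁ , L ∪ O₂ , D ⟩
    O₂-locked = record
      { O-split = ≃-refl
      ; X#O     = λ x o₂ o₁ → O₁#L∪O₂ x o₁ (inj₂ o₂)
      ; L-split = ≃-refl
      ; D-same  = ≃-refl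
      }
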